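{- Equip each zigzag snake graph $\mathcal{G}^z_N$ with its standard labeling. Then: (a) For every $n\ge2$, $|\Omega(\mathcal{G}^z_{n-1})| = C_n$. (b) For every $n\ge 3$ and $2\le k\le n+1$, the number of mixed dimer covers of $\mathcal{G}^z_{n-1}$ (standard labeling) whose final edge has multiplicity $n+1-k$ equals the number of mixed dimer covers of $\mathcal{G}^z_{n-2}$ with labeling $(1,2,\dots,n-2,\,n+1-k)$ (in the sense below), and both equal the ballot number $C_{n,n+2-k}$.
   Context: Mixed dimer covers: for a finite graph $\mathcal{G}=(V,E)$ and $\mathbf{n}\colon V\to\mathbb{N}$, a mixed dimer cover is a function $\omega\colon E\to\mathbb{N}$ with $\sum_{e\ni v}\omega(e)=\mathbf{n}(v)$ for each vertex $v$. Zigzag snake graph $\mathcal{G}^z_N$ ($N\ge1$): the union of $N$ unit squares (tiles) $T_1,\dots,T_N$ in the plane, with $T_{2j+1}$ having lower-left corner $(j,j)$ and $T_{2j}$ having lower-left corner $(j-1,j)$ (so $T_{i+1}$ lies above $T_i$ if $i$ is odd and to the right of $T_i$ if $i$ is even); vertices are the lattice points on the tiles, edges the unit sides. Its $2(N+1)$ vertices are partitioned into pairs $P_0,\dots,P_N$: for $1\le k\le N$, if $k=2j+1$ then $P_{k-1}=\{(j,j),(j+1,j)\}$, and if $k=2j$ then $P_{k-1}=\{(j-1,j),(j-1,j+1)\}$; $P_N$ consists of the two remaining vertices. For a sequence $(x_0,\dots,x_N)$ of non-negative integers, the labeling $(x_0,\dots,x_N)$ gives both vertices of $P_i$ the value $x_i$.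 The standard labeling is $(1,2,\dots,N+1)$, and $\Omega(\mathcal{G}^z_N)$ is the set of mixed dimer covers for it. The final edge of $\mathcal{G}^z_N$ is the right vertical edge of $T_N$ if $N$ is odd and the top horizontal edge of $T_N$ if $N$ is even. A permutation $\tau\in S_n$ is $132$-avoiding if there are no $j<k<\ell$ with $\tau(j)<\tau(\ell)<\tau(k)$. $C_n$ is the number of $132$-avoiding permutations in $S_n$ (the Catalan number), and the ballot number $C_{n,k}$ is the number of $132$-avoiding $\tau\in S_n$ with $\tau(1)=k$. -}

module Defs where

open import Data.Nat using (ℕ; zero; suc; _+_; _<ᵇ_)
open import Data.Nat.Properties using (_≟_)
open import Data.Product using (Σ; _×_; _,_; ∃)
open import Data.Product.Properties using (≡-dec)
open import Data.List using (List; []; _∷_; length; concatMap; deduplicate; upTo)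
open import Data.List.Relation.Unary.All using (All)
open import Data.Vec using (Vec; []; _∷_; lookup)
open import Data.Fin using (Fin; toℕ) renaming (_<_ to _<ᶠ_)
open import Data.Bool using (Bool; if_then_else_; _∨_)
open import Relation.Binary.PropositionalEquality using (_≡_)
open import Relation.Nullary using (¬_; does)
open import Relation.Binary.Definitions using (DecidableEquality)

Pt : Set
Pt = ℕ × ℕ

-- a unit segment, stored with its lower/left endpoint first
Seg : Set
Seg = Pt × Pt

_≟ₚ_ : DecidableEquality Pt
_≟ₚ_ = ≡-dec _≟_ _≟_

_≟ₛ_ : DecidableEquality Seg
_≟ₛ_ = ≡-dec _≟ₚ_ _≟ₚ_

shift : Pt → Pt
shift (x , y) = (suc x , suc y)

-- Zigzag snake graph G^z_N.  Tile index i (0-based) is T_{i+1}.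
-- corner i = lower-left corner of T_{i+1}:
--   T_{2j+1} ↦ (j , j),  T_{2j} ↦ (j-1 , j).

corner : ℕ → Pt
corner zero = (0 , 0)
corner (suc zero) = (0 , 1)
corner (suc (suc i)) = shift (corner i)

tileCorners : ℕ → List Pt
tileCorners i with corner i
... | (x , y) = (x , y) ∷ (suc x , y) ∷ (x , suc y) ∷ (suc x , suc y) ∷ []

bottomSide topSide leftSide rightSide : Pt → Seg
bottomSide (x , y) = ((x , y) , (suc x , y))
topSide    (x , y) = ((x , suc y) , (suc x , suc y))
leftSide   (x , y) = ((x , y) , (x , suc y))
rightSide  (x , y) = ((suc x , y) , (suc x , suc y))

tileSides : ℕ → List Seg
tileSides i = bottomSide (corner i) ∷ topSide (corner i)
            ∷ leftSide (corner i) ∷ rightSide (corner i) ∷ []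

vertices : ℕ → List Pt
vertices N = deduplicate _≟ₚ_ (concatMap tileCorners (upTo N))

edges : ℕ → List Seg
edges N = deduplicate _≟ₛ_ (concatMap tileSides (upTo N))

-- the final edge: right side of T_N if N odd, top side of T_N if N even
sideSel : ℕ → Pt → Seg
sideSel zero = rightSide
sideSel (suc zero) = topSide
sideSel (suc (suc i)) = sideSel i

finalEdge : ℕ → Seg
finalEdge N = sideSel (Data.Nat._∸_ N 1) (corner (Data.Nat._∸_ N 1))

-- Vertex pairs P_i (as the segment joining its two vertices), 0 ≤ i < N:
--   P_{2j}   = {(j , j) , (j+1 , j)}       (k = 2j+1)
--   P_{2j+1} = {(j , j+1) , (j , j+2)}     (k = 2j+2)

pair : ℕ → Seg
pair zero = ((0 , 0) , (1 , 0))
pair (suc zero) = ((0 , 1) , (0 , 2))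
pair (suc (suc i)) with pair i
... | (p , q) = (shift p , shift q)

isEnd : Pt → Seg → Bool
isEnd v (p , q) = does (v ≟ₚ p) ∨ does (v ≟ₚ q)

search : ℕ → ℕ → Pt → ℕ
search i zero v = i
search i (suc r) v = if isEnd v (pair i) then i else search (suc i) r v

pairIndex : ℕ → Pt → ℕ
pairIndex N v = search 0 N v

-- vertex label for the labeling (x_0 , … , x_N): vertices of P_i get x_i,
-- the two remaining vertices (P_N) get x_N
label : ℕ → (ℕ → ℕ) → Pt → ℕ
label N x v = x (pairIndex N v)

standard : ℕ → ℕ
standard i = suc i

lastLabel : ℕ → ℕ → ℕ → ℕ
lastLabel N y i = if i <ᵇ N then suc i else y

-- Mixed dimer covers: ω assigns a multiplicity to each edge (listed in
-- `edges N`), and at each vertex the multiplicities sum to its label.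

EdgeWeights : ℕ → Set
EdgeWeights N = Vec ℕ (length (edges N))

incSum : Pt → (es : List Seg) → Vec ℕ (length es) → ℕ
incSum v [] [] = 0
incSum v (e ∷ es) (w ∷ ω) = (if isEnd v e then w else 0) + incSum v es ω

mult : Seg → (es : List Seg) → Vec ℕ (length es) → ℕ
mult s [] [] = 0
mult s (e ∷ es) (w ∷ ω) = (if does (s ≟ₛ e) then w else 0) + mult s es ω

IsMixedDimerCover : (N : ℕ) → (ℕ → ℕ) → EdgeWeights N → Set
IsMixedDimerCover N x ω =
  All (λ v → incSum v (edges N) ω ≡ label N x v) (vertices N)

Card : {A : Set} → (A → Set) → ℕ → Set
Card {A} P c =
  Σ (Fin c → A) λ f →
    (∀ i → P (f i))
  × (∀ i j → f i ≡ f j → i ≡ j)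
  × (∀ a → P a → ∃ λ i → f i ≡ a)

-- Permutations of {1..n} as vectors (one-line notation, values in Fin n)

IsPerm : ∀ {n} → Vec (Fin n) n → Set
IsPerm τ = ∀ i j → lookup τ i ≡ lookup τ j → i ≡ j

Avoids132 : ∀ {n} → Vec (Fin n) n → Set
Avoids132 {n} τ = ¬ (Σ (Fin n) λ j → Σ (Fin n) λ k → Σ (Fin n) λ l →
  j <ᶠ k × k <ᶠ l × lookup τ j <ᶠ lookup τ l × lookup τ l <ᶠ lookup τ k)

-- τ(1) as a value in {1..n} (0 for the empty permutation)
firstValue : ∀ {n} → Vec (Fin n) n → ℕ
firstValue [] = 0
firstValue (a ∷ _) = suc (toℕ a)

{-# OPTIONS --safe #-}
module Submission where

-- Both counts satisfy the ballot recursion  ballot (n+1) v = Σ_{w ≤ min(n, v)} ballot n w.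
-- A 132-avoiding permutation with first entry v is v followed by a standardised 132-avoiding
-- permutation whose first entry w is at most v: a larger w together with the entry v + 1
-- would complete a 132 pattern.  In the snake, the last tile T_{m+2} adds the vertices outer m
-- (label m + 2) and spine (m + 2) (label y) and three edges.  Once the final edge carries x,
-- the conditions at these two vertices force the other new weights to be m + 2 - x and y - x,
-- and removing the tile leaves a cover of G_{m+1} whose final pair is labelled x.  As
-- x ≤ min(m + 2, y), grouping the covers by x gives the same recursion.

open import Defs
open import Data.Nat using (ℕ; zero; suc; _+_; _∸_; _⊓_; _≤_; _<_; _<ᵇ_; z≤n; s≤s; pred; _≤?_)
open import Data.Nat.Properties
  using ( ≤-refl; ≤-trans; ≤-pred; <-irrefl; <⇒≤; ≤⇒≯; ≰⇒>; <-≤-trans; ≤∧≢⇒<; <⇒≢; n<1+n; n≤1+n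
        ; m≤n⇒m<n∨m≡n; m≤n⇒m≤1+n; ≤-antisym; ≮⇒≥; m≤m+n; m≤n+m; _<?_; _≟_; <⇒<ᵇ; <ᵇ⇒<; suc-injective
        ; ⊓-glb; m⊓n≤m; m⊓n≤n; m≤n⇒m⊓n≡m
        ; +-assoc; +-comm; +-identityʳ; +-suc; +-cancelˡ-≡; +-cancelʳ-≡
        ; m∸n≤m; m∸n+n≡m; m+[n∸m]≡n; m+n∸n≡m; m+n∸m≡n; +-∸-assoc )
open import Data.Nat.Tactic.RingSolver using (solve-∀)
open import Data.Bool using (true; false; if_then_else_)
open import Data.Bool.Properties using (∨-zeroʳ)
open import Data.Fin using (Fin; toℕ; fromℕ<; punchIn; punchOut; splitAt; join; _↑ˡ_; _↑ʳ_)
  renaming (zero to fzero; suc to fsuc; _<_ to _<ᶠ_; _≤_ to _≤ᶠ_)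
open import Data.Fin.Properties
  using ( punchIn-injective; punchInᵢ≢i; punchIn-punchOut; punchOut-punchIn; punchOut-cong; punchOut-injective
        ; toℕ-injective; toℕ-fromℕ<; toℕ<n; any?; injective⇒≤; splitAt-↑ˡ; splitAt-↑ʳ; join-splitAt )
  renaming (_≟_ to _≟ᶠ_; suc-injective to fsuc-injective)
open import Data.Product using (Σ; _×_; _,_; ∃; proj₁; proj₂)
open import Data.Sum using (_⊎_; inj₁; inj₂)
open import Data.Empty using (⊥; ⊥-elim)
open import Data.List using (List; []; _∷_; _++_; [_]; length; filter; concatMap; deduplicate; upTo)
import Data.List as List
open import Data.List.Properties using (filter-accept; filter-reject; filter-++; filter-all; concatMap-++; applyUpTo-∷ʳ; ++-identityʳ)
open import Data.List.Relation.Unary.All using (All; []; _∷_)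
import Data.List.Relation.Unary.All as All
open import Data.List.Relation.Unary.All.Properties using (++⁺; ++⁻)
open import Data.List.Relation.Unary.Any using (here; there)
open import Data.List.Relation.Unary.AllPairs using ([]; _∷_)
open import Data.List.Relation.Unary.Unique.Propositional using (Unique)
open import Data.List.Membership.Propositional using (_∈_; _∉_)
open import Data.List.Membership.Propositional.Properties using (∈-deduplicate⁻; ∈-deduplicate⁺; ∈-++⁺ˡ; ∈-++⁺ʳ)
open import Data.Vec using (Vec; []; _∷_; lookup; map; head; tail)
open import Data.Vec.Properties using (lookup-map)
open import Function using (_∘_; id)
open import Relation.Nullary using (¬_; Dec; yes; no; ¬?; does)
open import Relation.Nullary.Decidable using (dec-true; dec-false)
open import Relation.Binary.Definitions using (DecidableEquality)
open import Relation.Binary.PropositionalEquality hiding ([_])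

sumBelow : ℕ → (ℕ → ℕ) → ℕ
sumBelow zero    c = 0
sumBelow (suc m) c = sumBelow m c + c m

module _ {A B : Set} {P : A → Set} {Q : B → Set} {c : ℕ} where

  Card-bijection : (f : A → B) (g : B → A) →
                   (∀ a → P a → Q (f a)) → (∀ b → Q b → P (g b)) →
                   (∀ a → P a → g (f a) ≡ a) → (∀ b → Q b → f (g b) ≡ b) →
                   Card P c → Card Q c
  Card-bijection f g PQ QP gf fg (e , Pe , e-inj , e-onto) =
      (λ i → f (e i))
    , (λ i → PQ _ (Pe i))
    , (λ i j eq → e-inj i j (begin
        e i         ≡⟨ gf _ (Pe i) ⟨
        g (f (e i)) ≡⟨ cong g eq ⟩
        g (f (e j)) ≡⟨ gf _ (Pe j) ⟩
        e j         ∎))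
    , λ b Qb → let (i , ei≡gb) = e-onto (g b) (QP b Qb)
               in i , trans (cong f ei≡gb) (fg b Qb)
    where open ≡-Reasoning

module _ {A : Set} {P Q : A → Set} {c : ℕ} where

  Card-resp : (∀ a → P a → Q a) → (∀ a → Q a → P a) → Card P c → Card Q c
  Card-resp PQ QP = Card-bijection (λ a → a) (λ a → a) PQ QP (λ _ _ → refl) (λ _ _ → refl)

module _ {A : Set} {P : A → Set} where

  Card-singleton : (a₀ : A) → P a₀ → (∀ a → P a → a ≡ a₀) → Card P 1
  Card-singleton a₀ Pa₀ unique =
    (λ _ → a₀) , (λ _ → Pa₀) , (λ { fzero fzero _ → refl }) , λ a Pa → fzero , sym (unique a Pa)

  Card-empty : (∀ a → ¬ P a) → Card P 0
  Card-empty ¬P = (λ ()) , (λ ()) , (λ ()) , λ a Pa → ⊥-elim (¬P a Pa)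

module _ {A : Set} {P : A → Set} where

  Card-split : (R : A → Set) → (∀ a → Dec (R a)) → ∀ {c₁ c₂} →
               Card (λ a → P a × R a) c₁ → Card (λ a → P a × ¬ R a) c₂ → Card P (c₁ + c₂)
  Card-split R R? {c₁} {c₂} (e₁ , Pe₁ , e₁-inj , e₁-onto) (e₂ , Pe₂ , e₂-inj , e₂-onto) =
    e , (λ i → Pe (splitAt c₁ i)) , e-inj , e-onto
    where
    e⊎ : Fin c₁ ⊎ Fin c₂ → A
    e⊎ (inj₁ i) = e₁ i
    e⊎ (inj₂ i) = e₂ i

    e : Fin (c₁ + c₂) → A
    e i = e⊎ (splitAt c₁ i)

    Pe : ∀ s → P (e⊎ s)
    Pe (inj₁ i) = proj₁ (Pe₁ i)
    Pe (inj₂ i) = proj₁ (Pe₂ i)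

    e⊎-inj : ∀ s t → e⊎ s ≡ e⊎ t → s ≡ t
    e⊎-inj (inj₁ i) (inj₁ j) eq = cong inj₁ (e₁-inj i j eq)
    e⊎-inj (inj₁ i) (inj₂ j) eq = ⊥-elim (proj₂ (Pe₂ j) (subst R eq (proj₂ (Pe₁ i))))
    e⊎-inj (inj₂ i) (inj₁ j) eq = ⊥-elim (proj₂ (Pe₂ i) (subst R (sym eq) (proj₂ (Pe₁ j))))
    e⊎-inj (inj₂ i) (inj₂ j) eq = cong inj₂ (e₂-inj i j eq)

    e-inj : ∀ i j → e i ≡ e j → i ≡ j
    e-inj i j eq = begin
      i                             ≡⟨ join-splitAt c₁ c₂ i ⟨
      join c₁ c₂ (splitAt c₁ i)     ≡⟨ cong (join c₁ c₂) (e⊎-inj (splitAt c₁ i) (splitAt c₁ j) eq) ⟩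
      join c₁ c₂ (splitAt c₁ j)     ≡⟨ join-splitAt c₁ c₂ j ⟩
      j                             ∎
      where open ≡-Reasoning

    e-onto : ∀ a → P a → ∃ λ i → e i ≡ a
    e-onto a Pa with R? a
    ... | yes Ra = let (i , e₁i≡a) = e₁-onto a (Pa , Ra)
                   in i ↑ˡ c₂ , trans (cong e⊎ (splitAt-↑ˡ c₁ i c₂)) e₁i≡a
    ... | no ¬Ra = let (i , e₂i≡a) = e₂-onto a (Pa , ¬Ra)
                   in c₁ ↑ʳ i , trans (cong e⊎ (splitAt-↑ʳ c₁ c₂ i)) e₂i≡a

module _ {A : Set} {P : A → Set} where

  Card-fibres : (h : A → ℕ) (m : ℕ) (c : ℕ → ℕ) → (∀ a → P a → h a < m) →
                (∀ i → i < m → Card (λ a → P a × h a ≡ i) (c i)) → Card P (sumBelow m c)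
  Card-fibres h m c h< fibre = Card-resp (λ a → proj₁) (λ a Pa → Pa , h< a Pa) (below m fibre)
    where
    below : ∀ k → (∀ i → i < k → Card (λ a → P a × h a ≡ i) (c i)) →
            Card (λ a → P a × h a < k) (sumBelow k c)
    below zero    _     = Card-empty λ { a (_ , ()) }
    below (suc k) fibre =
      Card-split (λ a → h a < k) (λ a → h a <? k)
        (Card-resp (λ a (Pa , hk) → (Pa , m≤n⇒m≤1+n hk) , hk)
                   (λ a ((Pa , _) , hk) → Pa , hk)
                   (below k λ i i<k → fibre i (m≤n⇒m≤1+n i<k)))
        (Card-resp (λ { a (Pa , refl) → (Pa , ≤-refl) , <-irrefl refl })
                   (λ { a ((Pa , s≤s hk≤k) , hk≮k) → Pa , ≤-antisym hk≤k (≮⇒≥ hk≮k) })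
                   (fibre k ≤-refl))

-- ballot n v is the ballot number C_{n+1,v+1}: the number of 132-avoiding
-- permutations of Fin (suc n) whose first entry is v.
ballot : ℕ → ℕ → ℕ
ballot zero    v = 1
ballot (suc n) v = sumBelow (suc (n ⊓ v)) (ballot n)

ballot-saturated : ∀ n v → n ≤ v → ballot (suc n) v ≡ sumBelow (suc n) (ballot n)
ballot-saturated n v n≤v = cong (λ k → sumBelow (suc k) (ballot n)) (m≤n⇒m⊓n≡m n≤v)

-- 132-avoiding permutations

toℕ-punchIn-≥ : ∀ {n} (i : Fin (suc n)) (x : Fin n) → i ≤ᶠ x → toℕ (punchIn i x) ≡ suc (toℕ x)
toℕ-punchIn-≥ fzero    x        _         = refl
toℕ-punchIn-≥ (fsuc i) (fsuc x) (s≤s i≤x) = cong suc (toℕ-punchIn-≥ i x i≤x)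

<-punchIn⇒≤ : ∀ {n} (i : Fin (suc n)) (x : Fin n) → i <ᶠ punchIn i x → i ≤ᶠ x
<-punchIn⇒≤ fzero    x        _         = z≤n
<-punchIn⇒≤ (fsuc i) (fsuc x) (s≤s i<x) = s≤s (<-punchIn⇒≤ i x i<x)

punchIn-mono-< : ∀ {n} (i : Fin (suc n)) (x y : Fin n) → x <ᶠ y → punchIn i x <ᶠ punchIn i y
punchIn-mono-< fzero    x        y        x<y       = s≤s x<y
punchIn-mono-< (fsuc i) fzero    (fsuc y) _         = s≤s z≤n
punchIn-mono-< (fsuc i) (fsuc x) (fsuc y) (s≤s x<y) = s≤s (punchIn-mono-< i x y x<y)

punchIn-cancel-< : ∀ {n} (i : Fin (suc n)) (x y : Fin n) → punchIn i x <ᶠ punchIn i y → x <ᶠ y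
punchIn-cancel-< fzero    x        y        (s≤s x<y) = x<y
punchIn-cancel-< (fsuc i) fzero    (fsuc y) _         = s≤s z≤n
punchIn-cancel-< (fsuc i) (fsuc x) (fsuc y) (s≤s x<y) = s≤s (punchIn-cancel-< i x y x<y)

IsPerm⇒surjective : ∀ {n} (σ : Vec (Fin n) n) → IsPerm σ → ∀ y → ∃ λ i → lookup σ i ≡ y
IsPerm⇒surjective {zero}  σ σ-perm ()
IsPerm⇒surjective {suc n} σ σ-perm y with any? (λ i → lookup σ i ≟ᶠ y)
... | yes hit = hit
... | no ¬hit = ⊥-elim (<-irrefl refl (injective⇒≤ {f = avoid-y} avoid-y-injective))
  where
  avoid-y : Fin (suc n) → Fin n
  avoid-y i = punchOut {i = y} λ y≡σi → ¬hit (i , sym y≡σi)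

  avoid-y-injective : ∀ {i j} → avoid-y i ≡ avoid-y j → i ≡ j
  avoid-y-injective {i} {j} eq =
    σ-perm i j (punchOut-injective (λ y≡σi → ¬hit (i , sym y≡σi)) (λ y≡σj → ¬hit (j , sym y≡σj)) eq)

-- Deleting the first entry v of a 132-avoiding permutation and standardising the rest is a
-- bijection onto the 132-avoiding permutations whose first entry is at most v.
module HeadDeletion {n v : ℕ} (v≤ : v ≤ suc n) where

  v̂ : Fin (suc (suc n))
  v̂ = fromℕ< (s≤s v≤)

  toℕ-v̂ : toℕ v̂ ≡ v
  toℕ-v̂ = toℕ-fromℕ< (s≤s v≤)

  prepend : Vec (Fin (suc n)) (suc n) → Vec (Fin (suc (suc n))) (suc (suc n))
  prepend σ = v̂ ∷ map (punchIn v̂) σ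

  -- v̂ itself is sent to the junk value zero; it never occurs in the tail of τ.
  removeV : Fin (suc (suc n)) → Fin (suc n)
  removeV x with v̂ ≟ᶠ x
  ... | yes _    = fzero
  ... | no v̂≢x = punchOut v̂≢x

  deleteHead : Vec (Fin (suc (suc n))) (suc (suc n)) → Vec (Fin (suc n)) (suc n)
  deleteHead τ = map removeV (tail τ)

  removeV-punchIn : ∀ x → removeV (punchIn v̂ x) ≡ x
  removeV-punchIn x with v̂ ≟ᶠ punchIn v̂ x
  ... | yes v̂≡ = ⊥-elim (punchInᵢ≢i v̂ x (sym v̂≡))
  ... | no _    = trans (punchOut-cong v̂ refl) (punchOut-punchIn v̂)

  punchIn-removeV : ∀ x → x ≢ v̂ → punchIn v̂ (removeV x) ≡ x
  punchIn-removeV x x≢v̂ with v̂ ≟ᶠ x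
  ... | yes v̂≡x = ⊥-elim (x≢v̂ (sym v̂≡x))
  ... | no v̂≢x = punchIn-punchOut v̂≢x

  Source : Vec (Fin (suc n)) (suc n) → Set
  Source σ = IsPerm σ × Avoids132 σ × toℕ (head σ) ≤ v

  Target : Vec (Fin (suc (suc n))) (suc (suc n)) → Set
  Target τ = IsPerm τ × Avoids132 τ × toℕ (head τ) ≡ v

  lookup-prepend : ∀ σ a → lookup (prepend σ) (fsuc a) ≡ punchIn v̂ (lookup σ a)
  lookup-prepend σ a = lookup-map a (punchIn v̂) σ

  prepend-perm : ∀ σ → IsPerm σ → IsPerm (prepend σ)
  prepend-perm σ σ-perm fzero    fzero    _  = refl
  prepend-perm σ σ-perm fzero    (fsuc b) eq = ⊥-elim (punchInᵢ≢i v̂ _ (sym (trans eq (lookup-prepend σ b))))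
  prepend-perm σ σ-perm (fsuc a) fzero    eq = ⊥-elim (punchInᵢ≢i v̂ _ (trans (sym (lookup-prepend σ a)) eq))
  prepend-perm σ σ-perm (fsuc a) (fsuc b) eq = cong fsuc (σ-perm a b (punchIn-injective v̂ _ _
    (trans (sym (lookup-prepend σ a)) (trans eq (lookup-prepend σ b)))))

  prepend-avoids : ∀ σ → Source σ → Avoids132 (prepend σ)
  prepend-avoids σ@(_ ∷ _) (σ-perm , σ-avoids , head≤v) = avoids
    where
    lift< : ∀ a b → lookup (prepend σ) (fsuc a) <ᶠ lookup (prepend σ) (fsuc b) → lookup σ a <ᶠ lookup σ b
    lift< a b lt = punchIn-cancel-< v̂ _ _
      (subst₂ _<ᶠ_ (lookup-prepend σ a) (lookup-prepend σ b) lt)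

    -- a pattern v, c, b in prepend σ gives lookup σ 0 ≤ v ≤ b < c, so c ≠ lookup σ 0 and
    -- lookup σ 0, c, b is a pattern in σ
    v≤σ : ∀ l → v̂ <ᶠ lookup (prepend σ) (fsuc l) → v ≤ toℕ (lookup σ l)
    v≤σ l lt = subst (_≤ toℕ (lookup σ l)) toℕ-v̂
      (<-punchIn⇒≤ v̂ _ (subst (v̂ <ᶠ_) (lookup-prepend σ l) lt))

    fromHead : ∀ k l → k <ᶠ l → v ≤ toℕ (lookup σ l) → lookup σ l <ᶠ lookup σ k → ⊥
    fromHead fzero     l _   v≤σl σl<σ0 = ≤⇒≯ (≤-trans head≤v v≤σl) σl<σ0
    fromHead (fsuc k)  l k<l v≤σl σl<σk = σ-avoids (fzero , fsuc k , l , s≤s z≤n , k<l , σ0<σl , σl<σk)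
      where
      σ0<σl : lookup σ fzero <ᶠ lookup σ l
      σ0<σl = ≤∧≢⇒< (≤-trans head≤v v≤σl) λ eq →
        <-irrefl (cong toℕ (σ-perm fzero l (toℕ-injective eq))) (≤-trans (s≤s z≤n) k<l)

    avoids : Avoids132 (prepend σ)
    avoids (fzero   , fsuc k , fsuc l , _ , s≤s k<l , v̂<τl , τl<τk) =
      fromHead k l k<l (v≤σ l v̂<τl) (lift< l k τl<τk)
    avoids (fsuc j , fsuc k , fsuc l , s≤s j<k , s≤s k<l , τj<τl , τl<τk) =
      σ-avoids (j , k , l , j<k , k<l , lift< j l τj<τl , lift< l k τl<τk)

  prepend-target : ∀ σ → Source σ → Target (prepend σ)
  prepend-target σ src@(σ-perm , _ , _) = prepend-perm σ σ-perm , prepend-avoids σ src , toℕ-v̂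

  module _ {x y : Fin (suc (suc n))} {ys : Vec (Fin (suc (suc n))) n} (target : Target (x ∷ y ∷ ys)) where

    private
      τ-perm : IsPerm (x ∷ y ∷ ys)
      τ-perm = proj₁ target

      τ-avoids : Avoids132 (x ∷ y ∷ ys)
      τ-avoids = proj₁ (proj₂ target)

      head≡v : toℕ x ≡ v
      head≡v = proj₂ (proj₂ target)

      xs : Vec (Fin (suc (suc n))) (suc n)
      xs = y ∷ ys

      σ : Vec (Fin (suc n)) (suc n)
      σ = deleteHead (x ∷ xs)

    x≡v̂ : x ≡ v̂
    x≡v̂ = toℕ-injective (trans head≡v (sym toℕ-v̂))

    tail≢v̂ : ∀ a → lookup xs a ≢ v̂
    tail≢v̂ a eq with τ-perm (fsuc a) fzero (trans eq (sym x≡v̂))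
    ... | ()

    punchIn-deleteHead : ∀ a → punchIn v̂ (lookup σ a) ≡ lookup xs a
    punchIn-deleteHead a = trans (cong (punchIn v̂) (lookup-map a removeV xs)) (punchIn-removeV _ (tail≢v̂ a))

    lower< : ∀ a b → lookup σ a <ᶠ lookup σ b → lookup xs a <ᶠ lookup xs b
    lower< a b lt = subst₂ _<ᶠ_ (punchIn-deleteHead a) (punchIn-deleteHead b) (punchIn-mono-< v̂ _ _ lt)

    deleteHead-perm : IsPerm σ
    deleteHead-perm a b eq = fsuc-injective (τ-perm (fsuc a) (fsuc b)
      (trans (sym (punchIn-deleteHead a)) (trans (cong (punchIn v̂) eq) (punchIn-deleteHead b))))

    deleteHead-avoids : Avoids132 σ
    deleteHead-avoids (j , k , l , j<k , k<l , σj<σl , σl<σk) =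
      τ-avoids (fsuc j , fsuc k , fsuc l , s≤s j<k , s≤s k<l , lower< j l σj<σl , lower< l k σl<σk)

    -- if lookup σ 0 > v, the entry v + 1 of τ occurs after position 1 and
    -- completes the pattern v, lookup σ 0 + 1, v + 1
    deleteHead-head≤ : toℕ (head σ) ≤ v
    deleteHead-head≤ with toℕ (head σ) ≤? v
    ... | yes σ0≤v = σ0≤v
    ... | no σ0≰v = ⊥-elim (τ-avoids (fzero , fsuc fzero , fsuc l , s≤s z≤n , s≤s (0<l l σl≡w) , v<τl , τl<τ1))
      where
      v<σ0 : v < toℕ (head σ)
      v<σ0 = ≰⇒> σ0≰v

      w : Fin (suc n)
      w = fromℕ< (<-≤-trans v<σ0 (<⇒≤ (toℕ<n (head σ))))

      toℕ-w : toℕ w ≡ v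
      toℕ-w = toℕ-fromℕ< _

      l : Fin (suc n)
      l = proj₁ (IsPerm⇒surjective σ deleteHead-perm w)

      σl≡w : lookup σ l ≡ w
      σl≡w = proj₂ (IsPerm⇒surjective σ deleteHead-perm w)

      0<l : ∀ l′ → lookup σ l′ ≡ w → 0 < toℕ l′
      0<l fzero    eq = ⊥-elim (<-irrefl (trans (sym toℕ-w) (cong toℕ (sym eq))) v<σ0)
      0<l (fsuc _) _  = s≤s z≤n

      τl≡v+1 : toℕ (lookup xs l) ≡ suc v
      τl≡v+1 = begin
        toℕ (lookup xs l)            ≡⟨ cong toℕ (punchIn-deleteHead l) ⟨
        toℕ (punchIn v̂ (lookup σ l)) ≡⟨ cong (toℕ ∘ punchIn v̂) σl≡w ⟩
        toℕ (punchIn v̂ w)            ≡⟨ toℕ-punchIn-≥ v̂ w (subst₂ _≤_ (sym toℕ-v̂) (sym toℕ-w) ≤-refl) ⟩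
        suc (toℕ w)                  ≡⟨ cong suc toℕ-w ⟩
        suc v                        ∎
        where open ≡-Reasoning

      τ1≡σ0+1 : toℕ (lookup xs fzero) ≡ suc (toℕ (head σ))
      τ1≡σ0+1 = trans (cong toℕ (sym (punchIn-deleteHead fzero)))
                      (toℕ-punchIn-≥ v̂ _ (subst (_≤ toℕ (head σ)) (sym toℕ-v̂) (<⇒≤ v<σ0)))

      v<τl : x <ᶠ lookup xs l
      v<τl = subst₂ _<_ (sym head≡v) (sym τl≡v+1) ≤-refl

      τl<τ1 : lookup xs l <ᶠ lookup xs fzero
      τl<τ1 = subst₂ _<_ (sym τl≡v+1) (sym τ1≡σ0+1) (s≤s v<σ0)

    deleteHead-source : Source σ
    deleteHead-source = deleteHead-perm , deleteHead-avoids , deleteHead-head≤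

    prepend-deleteHead : prepend σ ≡ x ∷ y ∷ ys
    prepend-deleteHead = cong₂ _∷_ (sym x≡v̂) (punchIn-removeV-all xs tail≢v̂)
      where
      punchIn-removeV-all : ∀ {k} (ys : Vec (Fin (suc (suc n))) k) → (∀ a → lookup ys a ≢ v̂) → map (punchIn v̂) (map removeV ys) ≡ ys
      punchIn-removeV-all []       _   = refl
      punchIn-removeV-all (y ∷ ys) ≢v̂ = cong₂ _∷_ (punchIn-removeV y (≢v̂ fzero)) (punchIn-removeV-all ys (≢v̂ ∘ fsuc))

  deleteHead-prepend : ∀ σ → deleteHead (prepend σ) ≡ σ
  deleteHead-prepend σ = removeV-punchIn-all σ
    where
    removeV-punchIn-all : ∀ {k} (ys : Vec (Fin (suc n)) k) → map removeV (map (punchIn v̂) ys) ≡ ys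
    removeV-punchIn-all []       = refl
    removeV-punchIn-all (y ∷ ys) = cong₂ _∷_ (removeV-punchIn y) (removeV-punchIn-all ys)

  Card-prepend : ∀ {c} → Card Source c → Card Target c
  Card-prepend = Card-bijection prepend deleteHead prepend-target
    (λ { (_ ∷ _ ∷ _) t → deleteHead-source t })
    (λ σ _ → deleteHead-prepend σ)
    (λ { (_ ∷ _ ∷ _) t → prepend-deleteHead t })

Card-avoiding-head : ∀ n v → v ≤ n →
  Card (λ (τ : Vec (Fin (suc n)) (suc n)) → IsPerm τ × Avoids132 τ × toℕ (head τ) ≡ v) (ballot n v)
Card-avoiding-head zero    zero    z≤n =
  Card-singleton (fzero ∷ []) (perm , avoids , refl) λ { (fzero ∷ []) _ → refl ; (fsuc () ∷ []) _ }
  where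
  perm : IsPerm (fzero ∷ [])
  perm fzero fzero _ = refl
  avoids : Avoids132 (fzero ∷ [])
  avoids (fzero , fzero , _ , () , _)
Card-avoiding-head (suc n) v       v≤  = HeadDeletion.Card-prepend v≤
  (Card-fibres (toℕ ∘ head) (suc (n ⊓ v)) (ballot n)
    (λ { (x ∷ _) (_ , _ , x≤v) → s≤s (⊓-glb (≤-pred (toℕ<n x)) x≤v) })
    λ { w (s≤s w≤) → Card-resp (λ { _ (perm , avoids , refl) → (perm , avoids , ≤-trans w≤ (m⊓n≤n n v)) , refl })
                               (λ { _ ((perm , avoids , _) , refl) → perm , avoids , refl })
                               (Card-avoiding-head n w (≤-trans w≤ (m⊓n≤m n v))) })

Card-avoiding : ∀ n →
  Card (λ (τ : Vec (Fin (suc n)) (suc n)) → IsPerm τ × Avoids132 τ) (sumBelow (suc n) (ballot n))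
Card-avoiding n = Card-fibres (toℕ ∘ head) (suc n) (ballot n) (λ { (x ∷ _) _ → toℕ<n x })
  λ { w (s≤s w≤n) → Card-resp (λ { _ (perm , avoids , refl) → (perm , avoids) , refl })
                              (λ { _ ((perm , avoids) , refl) → perm , avoids , refl })
                              (Card-avoiding-head n w w≤n) }

module _ {A : Set} (_≟ᴬ_ : DecidableEquality A) where

  open import Data.List.Membership.DecPropositional _≟ᴬ_ using (_∈?_)

  private
    dedup : List A → List A
    dedup = deduplicate _≟ᴬ_

    without : A → List A → List A
    without x = filter (¬? ∘ (x ≟ᴬ_))

  removeAll : List A → List A → List A
  removeAll []       ys = ys
  removeAll (x ∷ xs) ys = without x (removeAll xs ys)

  deduplicate-++ : ∀ xs ys → dedup (xs ++ ys) ≡ dedup xs ++ removeAll xs (dedup ys)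
  deduplicate-++ []       ys = refl
  deduplicate-++ (x ∷ xs) ys = cong (x ∷_) (begin
    without x (dedup (xs ++ ys))                           ≡⟨ cong (without x) (deduplicate-++ xs ys) ⟩
    without x (dedup xs ++ removeAll xs (dedup ys))        ≡⟨ filter-++ (¬? ∘ (x ≟ᴬ_)) (dedup xs) _ ⟩
    without x (dedup xs) ++ removeAll (x ∷ xs) (dedup ys)  ∎)
    where open ≡-Reasoning

  deduplicate-concatMap-upTo-suc : ∀ (f : ℕ → List A) n →
    dedup (concatMap f (upTo (suc n))) ≡ dedup (concatMap f (upTo n)) ++ removeAll (concatMap f (upTo n)) (dedup (f n))
  deduplicate-concatMap-upTo-suc f n = begin
    dedup (concatMap f (upTo (suc n)))           ≡⟨ cong (dedup ∘ concatMap f) (applyUpTo-∷ʳ id n) ⟨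
    dedup (concatMap f (upTo n ++ [ n ]))        ≡⟨ cong dedup (concatMap-++ f (upTo n) [ n ]) ⟩
    dedup (concatMap f (upTo n) ++ (f n ++ []))  ≡⟨ cong (dedup ∘ (concatMap f (upTo n) ++_)) (++-identityʳ (f n)) ⟩
    dedup (concatMap f (upTo n) ++ f n)          ≡⟨ deduplicate-++ (concatMap f (upTo n)) (f n) ⟩
    dedup (concatMap f (upTo n)) ++ removeAll (concatMap f (upTo n)) (dedup (f n)) ∎
    where open ≡-Reasoning

  deduplicate-unique : ∀ {xs} → Unique xs → dedup xs ≡ xs
  deduplicate-unique {[]}     []               = refl
  deduplicate-unique {x ∷ xs} (x∉xs ∷ xs-uniq) =
    cong (x ∷_) (trans (cong (without x) (deduplicate-unique xs-uniq)) (filter-all (¬? ∘ (x ≟ᴬ_)) x∉xs))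

  removeAll-[] : ∀ xs → removeAll xs [] ≡ []
  removeAll-[] []       = refl
  removeAll-[] (x ∷ xs) = cong (without x) (removeAll-[] xs)

  removeAll-∉ : ∀ xs {y} ys → y ∉ xs → removeAll xs (y ∷ ys) ≡ y ∷ removeAll xs ys
  removeAll-∉ []       ys _    = refl
  removeAll-∉ (x ∷ xs) ys y∉ =
    trans (cong (without x) (removeAll-∉ xs ys (y∉ ∘ there)))
          (filter-accept (¬? ∘ (x ≟ᴬ_)) λ x≡y → y∉ (here (sym x≡y)))

  removeAll-∈ : ∀ xs {y} ys → y ∈ xs → removeAll xs (y ∷ ys) ≡ removeAll xs ys
  removeAll-∈ (x ∷ xs) {y} ys y∈ with y ∈? xs
  ... | yes y∈xs = cong (without x) (removeAll-∈ xs ys y∈xs)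
  ... | no y∉xs with y∈
  ...   | there y∈xs = ⊥-elim (y∉xs y∈xs)
  ...   | here refl  = trans (cong (without x) (removeAll-∉ xs ys y∉xs))
                             (filter-reject (¬? ∘ (x ≟ᴬ_)) λ x≢x → x≢x refl)

-- The zigzag snake graph

_∈ₛ_ : Pt → Seg → Set
v ∈ₛ (p , q) = v ≡ p ⊎ v ≡ q

isEnd-∈ₛ : ∀ {v s} → v ∈ₛ s → isEnd v s ≡ true
isEnd-∈ₛ {v} {p , q} (inj₁ v≡p) rewrite dec-true (v ≟ₚ p) v≡p = refl
isEnd-∈ₛ {v} {p , q} (inj₂ v≡q) rewrite dec-true (v ≟ₚ q) v≡q = ∨-zeroʳ _

isEnd-∉ₛ : ∀ {v s} → ¬ v ∈ₛ s → isEnd v s ≡ false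
isEnd-∉ₛ {v} {p , q} v∉ rewrite dec-false (v ≟ₚ p) (v∉ ∘ inj₁) | dec-false (v ≟ₚ q) (v∉ ∘ inj₂) = refl

-- the index of the pair P_i containing a point of the snake: P_{2j} lies on the
-- line y = j and P_{2j+1} on x = j
pairOf : Pt → ℕ
pairOf (_     , zero)  = 0
pairOf (zero  , suc _) = 1
pairOf (suc x , suc y) = suc (suc (pairOf (x , y)))

pairOf-∈ₛ : ∀ i {v} → v ∈ₛ pair i → pairOf v ≡ i
pairOf-∈ₛ zero          (inj₁ refl) = refl
pairOf-∈ₛ zero          (inj₂ refl) = refl
pairOf-∈ₛ (suc zero)    (inj₁ refl) = refl
pairOf-∈ₛ (suc zero)    (inj₂ refl) = refl
pairOf-∈ₛ (suc (suc i)) (inj₁ refl) = cong (suc ∘ suc) (pairOf-∈ₛ i (inj₁ refl))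
pairOf-∈ₛ (suc (suc i)) (inj₂ refl) = cong (suc ∘ suc) (pairOf-∈ₛ i (inj₂ refl))

pairs-disjoint : ∀ {v w i j} → v ∈ₛ pair i → w ∈ₛ pair j → v ≡ w → i ≡ j
pairs-disjoint {i = i} {j} v∈ w∈ refl = trans (sym (pairOf-∈ₛ i v∈)) (pairOf-∈ₛ j w∈)

pairs-apart : ∀ {v w i j} → v ∈ₛ pair i → w ∈ₛ pair j → i < j → v ≢ w
pairs-apart v∈ w∈ i<j = <⇒≢ i<j ∘ pairs-disjoint v∈ w∈

shift-injective : ∀ {p q} → shift p ≡ shift q → p ≡ q
shift-injective refl = refl

pair-endpoints-distinct : ∀ i → proj₁ (pair i) ≢ proj₂ (pair i)
pair-endpoints-distinct zero          ()
pair-endpoints-distinct (suc zero)    ()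
pair-endpoints-distinct (suc (suc i)) eq = pair-endpoints-distinct i (shift-injective eq)

-- P_{j+1} = {spine j , outer j}; the spine is the staircase (0,1), (1,1), (1,2), (2,2), …
spine outer : ℕ → Pt
spine j = proj₁ (pair (suc j))
outer j = proj₂ (pair (suc j))

spine∈ₛ : ∀ j → spine j ∈ₛ pair (suc j)
spine∈ₛ j = inj₁ refl

outer∈ₛ : ∀ j → outer j ∈ₛ pair (suc j)
outer∈ₛ j = inj₂ refl

spine-injective : ∀ {i j} → spine i ≡ spine j → i ≡ j
spine-injective {i} {j} = suc-injective ∘ pairs-disjoint (spine∈ₛ i) (spine∈ₛ j)

spine≢outer : ∀ i j → spine i ≢ outer j
spine≢outer i j eq with suc-injective {i} {j} (pairs-disjoint (spine∈ₛ i) (outer∈ₛ j) eq)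
... | refl = pair-endpoints-distinct (suc i) eq

spine-≢ : ∀ {i j} → i < j → spine i ≢ spine j
spine-≢ {i} {j} i<j = <⇒≢ i<j ∘ spine-injective {i} {j}

∉-ends : ∀ {v p q} → v ≢ p → v ≢ q → ¬ v ∈ₛ (p , q)
∉-ends v≢p v≢q (inj₁ v≡p) = v≢p v≡p
∉-ends v≢p v≢q (inj₂ v≡q) = v≢q v≡q

module _ {v : Pt} {p : ℕ} (v∈ : v ∈ₛ pair p) where

  private
    v∈⇒≡p : ∀ i → v ∈ₛ pair i → i ≡ p
    v∈⇒≡p i v∈i = pairs-disjoint v∈i v∈ refl

  search-found : ∀ s r → s ≤ p → p < s + r → search s r v ≡ p
  search-found s zero    s≤p p<s = ⊥-elim (≤⇒≯ s≤p (subst (p <_) (+-identityʳ s) p<s))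
  search-found s (suc r) s≤p p< with s ≟ p
  ... | yes refl rewrite isEnd-∈ₛ v∈ = refl
  ... | no s≢p rewrite isEnd-∉ₛ {v} {pair s} (s≢p ∘ v∈⇒≡p s) =
    search-found (suc s) r (≤∧≢⇒< s≤p s≢p) (subst (p <_) (+-suc s r) p<)

  search-missed : ∀ s r → s + r ≤ p → search s r v ≡ s + r
  search-missed s zero    _   = sym (+-identityʳ s)
  search-missed s (suc r) s+r≤p with s+1+r≤p ← subst (_≤ p) (+-suc s r) s+r≤p
    rewrite isEnd-∉ₛ {v} {pair s} λ v∈s → <⇒≢ (≤-trans (s≤s (m≤m+n s r)) s+1+r≤p) (v∈⇒≡p s v∈s) =
    trans (search-missed (suc s) r s+1+r≤p) (sym (+-suc s r))

  pairIndex-< : ∀ N → p < N → pairIndex N v ≡ p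
  pairIndex-< N p<N = search-found 0 N z≤n p<N

  pairIndex-≥ : ∀ N → N ≤ p → pairIndex N v ≡ N
  pairIndex-≥ N N≤p = search-missed 0 N N≤p

search-≤ : ∀ s r v → search s r v ≤ s + r
search-≤ s zero    v = subst (s ≤_) (sym (+-identityʳ s)) ≤-refl
search-≤ s (suc r) v with isEnd v (pair s)
... | true  = m≤m+n s (suc r)
... | false = subst (search (suc s) r v ≤_) (sym (+-suc s r)) (search-≤ (suc s) r v)

pairIndex-≤ : ∀ N v → pairIndex N v ≤ N
pairIndex-≤ N v = search-≤ 0 N v

lastLabel-< : ∀ {N y p} → p < N → lastLabel N y p ≡ suc p
lastLabel-< {N} {y} {p} p<N with p <ᵇ N | <⇒<ᵇ p<N
... | true | _ = refl

lastLabel-≥ : ∀ {N y p} → N ≤ p → lastLabel N y p ≡ y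
lastLabel-≥ {N} {y} {p} N≤p with p <ᵇ N | <ᵇ⇒< p N
... | false | _   = refl
... | true  | p<N = ⊥-elim (≤⇒≯ N≤p (p<N _))

module _ {v : Pt} {p : ℕ} (v∈ : v ∈ₛ pair p) (N y : ℕ) where

  label-< : p < N → label N (lastLabel N y) v ≡ suc p
  label-< p<N rewrite pairIndex-< v∈ N p<N = lastLabel-< p<N

  label-≥ : N ≤ p → label N (lastLabel N y) v ≡ y
  label-≥ N≤p rewrite pairIndex-≥ v∈ N N≤p = lastLabel-≥ ≤-refl

label-standard : ∀ N v → label N (lastLabel N (suc N)) v ≡ label N standard v
label-standard N v with pairIndex N v | pairIndex-≤ N v
... | i | i≤N with m≤n⇒m<n∨m≡n i≤N
...   | inj₁ i<N  = lastLabel-< i<N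
...   | inj₂ refl = lastLabel-≥ ≤-refl

byParity : {X : Set} → ℕ → X → X → X
byParity zero          x y = x
byParity (suc zero)    x y = y
byParity (suc (suc m)) x y = byParity m x y

byParity-map : ∀ {X Y : Set} (f : X → Y) m x y → f (byParity m x y) ≡ byParity m (f x) (f y)
byParity-map f zero          x y = refl
byParity-map f (suc zero)    x y = refl
byParity-map f (suc (suc m)) x y = byParity-map f m x y

byParity-elim : ∀ {X : Set} (P : X → Set) m {x y} → P x → P y → P (byParity m x y)
byParity-elim P zero          px py = px
byParity-elim P (suc zero)    px py = py
byParity-elim P (suc (suc m)) px py = byParity-elim P m px py

byParity-elim₂ : ∀ {X Y : Set} (R : X → Y → Set) m {x₁ x₂ y₁ y₂} →
                 R x₁ y₁ → R x₂ y₂ → R (byParity m x₁ x₂) (byParity m y₁ y₂)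
byParity-elim₂ R zero          r₁ r₂ = r₁
byParity-elim₂ R (suc zero)    r₁ r₂ = r₂
byParity-elim₂ R (suc (suc m)) r₁ r₂ = byParity-elim₂ R m r₁ r₂

shiftₛ : Seg → Seg
shiftₛ (p , q) = (shift p , shift q)

spineSide finalSide : ℕ → Seg
spineSide j = (spine j , spine (suc j))
finalSide j = (outer j , spine (suc (suc j)))

tileCorners-suc : ∀ m → tileCorners (suc m) ≡
  byParity m (spine m ∷ spine (suc m) ∷ outer m ∷ spine (suc (suc m)) ∷ [])
             (spine m ∷ outer m ∷ spine (suc m) ∷ spine (suc (suc m)) ∷ [])
tileCorners-suc zero          = refl
tileCorners-suc (suc zero)    = refl
tileCorners-suc (suc (suc m)) = trans (cong (List.map shift) (tileCorners-suc m)) (byParity-map (List.map shift) m _ _)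

tileSides-suc : ∀ m → tileSides (suc m) ≡
  byParity m (spineSide m ∷ finalSide m ∷ pair (suc m) ∷ spineSide (suc m) ∷ [])
             (pair (suc m) ∷ spineSide (suc m) ∷ spineSide m ∷ finalSide m ∷ [])
tileSides-suc zero          = refl
tileSides-suc (suc zero)    = refl
tileSides-suc (suc (suc m)) = trans (cong (List.map shiftₛ) (tileSides-suc m)) (byParity-map (List.map shiftₛ) m _ _)

finalEdge-suc : ∀ m → finalEdge (suc (suc m)) ≡ finalSide m
finalEdge-suc m = go m
  where
  sideSel-shift : ∀ k p → sideSel k (shift p) ≡ shiftₛ (sideSel k p)
  sideSel-shift zero          p = refl
  sideSel-shift (suc zero)    p = refl
  sideSel-shift (suc (suc k)) p = sideSel-shift k p

  go : ∀ m → sideSel (suc m) (corner (suc m)) ≡ finalSide m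
  go zero          = refl
  go (suc zero)    = refl
  go (suc (suc m)) = trans (sideSel-shift (suc m) (corner (suc m))) (cong shiftₛ (go m))

-- the corners and sides of T_{m+2}: d is shared with T_{m+1}, and b is the final edge of G_{m+2}
module Tile (m : ℕ) where

  s₀ s₁ s₂ o : Pt
  s₀ = spine m
  s₁ = spine (suc m)
  s₂ = spine (suc (suc m))
  o  = outer m

  a b c d : Seg
  a = pair (suc m)
  b = finalSide m
  c = spineSide (suc m)
  d = spineSide m

  s₀≢s₁ : s₀ ≢ s₁
  s₀≢s₁ = spine-≢ (n<1+n m)

  s₁≢s₂ : s₁ ≢ s₂
  s₁≢s₂ = spine-≢ (n<1+n (suc m))

  s₀≢s₂ : s₀ ≢ s₂
  s₀≢s₂ = spine-≢ (m≤n+m (suc m) 1)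

  s₀≢o : s₀ ≢ o
  s₀≢o = spine≢outer m m

  s₁≢o : s₁ ≢ o
  s₁≢o = spine≢outer (suc m) m

  s₂≢o : s₂ ≢ o
  s₂≢o = spine≢outer (suc (suc m)) m

module _ {A B : Set} where

  glue : (xs ys : List A) → Vec B (length xs) → Vec B (length ys) → Vec B (length (xs ++ ys))
  glue []       ys []      ν = ν
  glue (x ∷ xs) ys (w ∷ ω) ν = w ∷ glue xs ys ω ν

  leftPart : (xs ys : List A) → Vec B (length (xs ++ ys)) → Vec B (length xs)
  leftPart []       ys ω       = []
  leftPart (x ∷ xs) ys (w ∷ ω) = w ∷ leftPart xs ys ω

  rightPart : (xs ys : List A) → Vec B (length (xs ++ ys)) → Vec B (length ys)
  rightPart []       ys ω       = ω
  rightPart (x ∷ xs) ys (w ∷ ω) = rightPart xs ys ω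

  glue-parts : ∀ xs ys ω → glue xs ys (leftPart xs ys ω) (rightPart xs ys ω) ≡ ω
  glue-parts []       ys ω       = refl
  glue-parts (x ∷ xs) ys (w ∷ ω) = cong (w ∷_) (glue-parts xs ys ω)

  leftPart-glue : ∀ xs ys ω ν → leftPart xs ys (glue xs ys ω ν) ≡ ω
  leftPart-glue []       ys []      ν = refl
  leftPart-glue (x ∷ xs) ys (w ∷ ω) ν = cong (w ∷_) (leftPart-glue xs ys ω ν)

  glue-elim : ∀ xs ys (P : Vec B (length (xs ++ ys)) → Set) → (∀ ω ν → P (glue xs ys ω ν)) → ∀ ω → P ω
  glue-elim xs ys P P-glue ω = subst P (glue-parts xs ys ω) (P-glue (leftPart xs ys ω) (rightPart xs ys ω))

weightAt : Pt → Seg → ℕ → ℕ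
weightAt v e w = if isEnd v e then w else 0

weightOn : Seg → Seg → ℕ → ℕ
weightOn s e w = if does (s ≟ₛ e) then w else 0

weightAt-∈ₛ : ∀ {v e} w → v ∈ₛ e → weightAt v e w ≡ w
weightAt-∈ₛ {v} {e} w v∈ rewrite isEnd-∈ₛ v∈ = refl

weightAt-∉ₛ : ∀ {v e} w → ¬ v ∈ₛ e → weightAt v e w ≡ 0
weightAt-∉ₛ {v} {e} w v∉ rewrite isEnd-∉ₛ {v} {e} v∉ = refl

weightOn-≡ : ∀ {s} w → weightOn s s w ≡ w
weightOn-≡ {s} w rewrite dec-true (s ≟ₛ s) refl = refl

weightOn-≢ : ∀ {s e} w → s ≢ e → weightOn s e w ≡ 0
weightOn-≢ {s} {e} w s≢e rewrite dec-false (s ≟ₛ e) s≢e = refl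

incSum-glue : ∀ v xs ys (ω : Vec ℕ (length xs)) ν → incSum v (xs ++ ys) (glue xs ys ω ν) ≡ incSum v xs ω + incSum v ys ν
incSum-glue v []       ys []      ν = refl
incSum-glue v (x ∷ xs) ys (w ∷ ω) ν =
  trans (cong (weightAt v x w +_) (incSum-glue v xs ys ω ν)) (sym (+-assoc (weightAt v x w) _ _))

mult-glue : ∀ s xs ys (ω : Vec ℕ (length xs)) ν → mult s (xs ++ ys) (glue xs ys ω ν) ≡ mult s xs ω + mult s ys ν
mult-glue s []       ys []      ν = refl
mult-glue s (x ∷ xs) ys (w ∷ ω) ν =
  trans (cong (weightOn s x w +_) (mult-glue s xs ys ω ν)) (sym (+-assoc (weightOn s x w) _ _))

incSum-away : ∀ v es (ω : Vec ℕ (length es)) → All (λ e → ¬ v ∈ₛ e) es → incSum v es ω ≡ 0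
incSum-away v []       []      []           = refl
incSum-away v (e ∷ es) (w ∷ ω) (v∉e ∷ v∉es) rewrite weightAt-∉ₛ {v} {e} w v∉e = incSum-away v es ω v∉es

mult-away : ∀ s es (ω : Vec ℕ (length es)) → All (s ≢_) es → mult s es ω ≡ 0
mult-away s []       []      []           = refl
mult-away s (e ∷ es) (w ∷ ω) (s≢e ∷ s≢es) rewrite weightOn-≢ {s} {e} w s≢e = mult-away s es ω s≢es

-- a, b, c in the order in which T_{m+2} contributes them to edges (m+2); the length of
-- byParity₃ m is 3 only after case analysis on m, hence the accessors weightA, weightB, weightC
module _ {a b c : Seg} where

  byParity₃ : ℕ → List Seg
  byParity₃ m = byParity m (b ∷ a ∷ c ∷ []) (a ∷ c ∷ b ∷ [])

  weightA weightB weightC : ∀ m → Vec ℕ (length (byParity₃ m)) → ℕ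
  weightA zero          (β ∷ α ∷ γ ∷ []) = α
  weightA (suc zero)    (α ∷ γ ∷ β ∷ []) = α
  weightA (suc (suc m)) ν                = weightA m ν
  weightB zero          (β ∷ α ∷ γ ∷ []) = β
  weightB (suc zero)    (α ∷ γ ∷ β ∷ []) = β
  weightB (suc (suc m)) ν                = weightB m ν
  weightC zero          (β ∷ α ∷ γ ∷ []) = γ
  weightC (suc zero)    (α ∷ γ ∷ β ∷ []) = γ
  weightC (suc (suc m)) ν                = weightC m ν

  fromWeights : ∀ m → ℕ → ℕ → ℕ → Vec ℕ (length (byParity₃ m))
  fromWeights zero          α β γ = β ∷ α ∷ γ ∷ []
  fromWeights (suc zero)    α β γ = α ∷ γ ∷ β ∷ []
  fromWeights (suc (suc m)) α β γ = fromWeights m α β γ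

  weightA-fromWeights : ∀ m α β γ → weightA m (fromWeights m α β γ) ≡ α
  weightA-fromWeights zero          α β γ = refl
  weightA-fromWeights (suc zero)    α β γ = refl
  weightA-fromWeights (suc (suc m)) α β γ = weightA-fromWeights m α β γ

  weightB-fromWeights : ∀ m α β γ → weightB m (fromWeights m α β γ) ≡ β
  weightB-fromWeights zero          α β γ = refl
  weightB-fromWeights (suc zero)    α β γ = refl
  weightB-fromWeights (suc (suc m)) α β γ = weightB-fromWeights m α β γ

  weightC-fromWeights : ∀ m α β γ → weightC m (fromWeights m α β γ) ≡ γ
  weightC-fromWeights zero          α β γ = refl
  weightC-fromWeights (suc zero)    α β γ = refl
  weightC-fromWeights (suc (suc m)) α β γ = weightC-fromWeights m α β γ

  fromWeights-weights : ∀ m ν → fromWeights m (weightA m ν) (weightB m ν) (weightC m ν) ≡ ν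
  fromWeights-weights zero          (β ∷ α ∷ γ ∷ []) = refl
  fromWeights-weights (suc zero)    (α ∷ γ ∷ β ∷ []) = refl
  fromWeights-weights (suc (suc m)) ν                = fromWeights-weights m ν

  incSum-byParity₃ : ∀ m v ν → incSum v (byParity₃ m) ν ≡
    weightAt v a (weightA m ν) + weightAt v b (weightB m ν) + weightAt v c (weightC m ν)
  incSum-byParity₃ zero          v (β ∷ α ∷ γ ∷ []) = even (weightAt v a α) (weightAt v b β) (weightAt v c γ)
    where even : ∀ x y z → y + (x + (z + 0)) ≡ x + y + z
          even = solve-∀
  incSum-byParity₃ (suc zero)    v (α ∷ γ ∷ β ∷ []) = odd (weightAt v a α) (weightAt v b β) (weightAt v c γ)
    where odd : ∀ x y z → x + (z + (y + 0)) ≡ x + y + z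
          odd = solve-∀
  incSum-byParity₃ (suc (suc m)) v ν                = incSum-byParity₃ m v ν

  mult-byParity₃-b : ∀ m ν → b ≢ a → b ≢ c → mult b (byParity₃ m) ν ≡ weightB m ν
  mult-byParity₃-b zero          (β ∷ α ∷ γ ∷ []) b≢a b≢c
    rewrite weightOn-≡ {b} β | weightOn-≢ α b≢a | weightOn-≢ γ b≢c = +-identityʳ β
  mult-byParity₃-b (suc zero)    (α ∷ γ ∷ β ∷ []) b≢a b≢c
    rewrite weightOn-≡ {b} β | weightOn-≢ α b≢a | weightOn-≢ γ b≢c = +-identityʳ β
  mult-byParity₃-b (suc (suc m)) ν                b≢a b≢c = mult-byParity₃-b m ν b≢a b≢c

-- Adding a tile

-- the vertices of G_{m+1}: those of P_0, …, P_m and its final pair {spine m , spine (m+1)}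
Old : ℕ → Pt → Set
Old m v = (Σ ℕ λ p → p ≤ m × v ∈ₛ pair p) ⊎ v ≡ spine m ⊎ v ≡ spine (suc m)

OldSide : ℕ → Seg → Set
OldSide m (p , q) = Old m p × Old m q

Old-suc : ∀ {m v} → Old m v → Old (suc m) v
Old-suc (inj₁ (p , p≤m , v∈)) = inj₁ (p , m≤n⇒m≤1+n p≤m , v∈)
Old-suc (inj₂ (inj₁ refl))     = inj₁ (_ , ≤-refl , inj₁ refl)
Old-suc (inj₂ (inj₂ refl))     = inj₂ (inj₁ refl)

module _ (m : ℕ) where

  open Tile m

  outer-new : ¬ Old m o
  outer-new (inj₁ (p , p≤m , o∈)) = <⇒≢ (s≤s p≤m) (pairs-disjoint o∈ (outer∈ₛ m) refl)
  outer-new (inj₂ (inj₁ o≡s₀))    = s₀≢o (sym o≡s₀)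
  outer-new (inj₂ (inj₂ o≡s₁))    = s₁≢o (sym o≡s₁)

  spine-new : ¬ Old m s₂
  spine-new (inj₁ (p , p≤m , s₂∈)) =
    <⇒≢ (s≤s (≤-trans p≤m (m≤n+m m 2))) (pairs-disjoint s₂∈ (spine∈ₛ (suc (suc m))) refl)
  spine-new (inj₂ (inj₁ s₂≡s₀))    = s₀≢s₂ (sym s₂≡s₀)
  spine-new (inj₂ (inj₂ s₂≡s₁))    = s₁≢s₂ (sym s₂≡s₁)

newEdges : ℕ → List Seg
newEdges m = byParity₃ {a} {b} {c} m
  where open Tile m

newVertices : ℕ → List Pt
newVertices m = outer m ∷ spine (suc (suc m)) ∷ []

record SnakeShape (m : ℕ) : Set where
  field
    vertices-old       : All (Old m) (vertices (suc m))
    edges-old          : All (OldSide m) (edges (suc m))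
    spine∈vertices     : spine m ∈ vertices (suc m)
    spine-suc∈vertices : spine (suc m) ∈ vertices (suc m)
    spineSide∈edges    : spineSide m ∈ edges (suc m)

≢-fst : ∀ {p q p′ q′ : Pt} → p ≢ p′ → (p , q) ≢ (p′ , q′)
≢-fst p≢p′ = p≢p′ ∘ cong proj₁

≢-snd : ∀ {p q p′ q′ : Pt} → q ≢ q′ → (p , q) ≢ (p′ , q′)
≢-snd q≢q′ = q≢q′ ∘ cong proj₂

module Growth (m : ℕ) (shape : SnakeShape m) where

  open SnakeShape shape
  open Tile m

  private
    rawEdges : List Seg
    rawEdges = concatMap tileSides (upTo (suc m))

    rawVertices : List Pt
    rawVertices = concatMap tileCorners (upTo (suc m))

    side∉ : ∀ {s} → ¬ OldSide m s → s ∉ rawEdges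
    side∉ ¬old s∈ = ¬old (All.lookup edges-old (∈-deduplicate⁺ _≟ₛ_ s∈))

    vertex∉ : ∀ {v} → ¬ Old m v → v ∉ rawVertices
    vertex∉ ¬old v∈ = ¬old (All.lookup vertices-old (∈-deduplicate⁺ _≟ₚ_ v∈))

    newSides : removeAll _≟ₛ_ rawEdges (deduplicate _≟ₛ_ (tileSides (suc m))) ≡ newEdges m
    newSides = trans (cong (removeAll _≟ₛ_ rawEdges ∘ deduplicate _≟ₛ_) (tileSides-suc m))
      (byParity-elim₂ (λ sides new → removeAll _≟ₛ_ rawEdges (deduplicate _≟ₛ_ sides) ≡ new) m even odd)
      where
      a∉ : a ∉ rawEdges
      a∉ = side∉ (outer-new m ∘ proj₂)
      b∉ : b ∉ rawEdges
      b∉ = side∉ (outer-new m ∘ proj₁)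
      c∉ : c ∉ rawEdges
      c∉ = side∉ (spine-new m ∘ proj₂)
      d∈ : d ∈ rawEdges
      d∈ = ∈-deduplicate⁻ _≟ₛ_ rawEdges spineSide∈edges

      even : removeAll _≟ₛ_ rawEdges (deduplicate _≟ₛ_ (d ∷ b ∷ a ∷ c ∷ [])) ≡ b ∷ a ∷ c ∷ []
      even rewrite deduplicate-unique _≟ₛ_ {d ∷ b ∷ a ∷ c ∷ []}
                     ( (≢-fst s₀≢o ∷ ≢-snd s₁≢o ∷ ≢-fst s₀≢s₁ ∷ [])
                     ∷ (≢-fst (≢-sym s₀≢o) ∷ ≢-fst (≢-sym s₁≢o) ∷ [])
                     ∷ (≢-fst s₀≢s₁ ∷ []) ∷ [] ∷ [])
                 | removeAll-∈ _≟ₛ_ rawEdges (b ∷ a ∷ c ∷ []) d∈ | removeAll-∉ _≟ₛ_ rawEdges (a ∷ c ∷ []) b∉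
                 | removeAll-∉ _≟ₛ_ rawEdges (c ∷ []) a∉ | removeAll-∉ _≟ₛ_ rawEdges [] c∉
                 | removeAll-[] _≟ₛ_ rawEdges = refl

      odd : removeAll _≟ₛ_ rawEdges (deduplicate _≟ₛ_ (a ∷ c ∷ d ∷ b ∷ [])) ≡ a ∷ c ∷ b ∷ []
      odd rewrite deduplicate-unique _≟ₛ_ {a ∷ c ∷ d ∷ b ∷ []}
                    ( (≢-fst s₀≢s₁ ∷ ≢-snd (≢-sym s₁≢o) ∷ ≢-fst s₀≢o ∷ [])
                    ∷ (≢-fst (≢-sym s₀≢s₁) ∷ ≢-fst s₁≢o ∷ [])
                    ∷ (≢-fst s₀≢o ∷ []) ∷ [] ∷ [])
                | removeAll-∉ _≟ₛ_ rawEdges (c ∷ d ∷ b ∷ []) a∉ | removeAll-∉ _≟ₛ_ rawEdges (d ∷ b ∷ []) c∉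
                | removeAll-∈ _≟ₛ_ rawEdges (b ∷ []) d∈ | removeAll-∉ _≟ₛ_ rawEdges [] b∉
                | removeAll-[] _≟ₛ_ rawEdges = refl

    newCorners : removeAll _≟ₚ_ rawVertices (deduplicate _≟ₚ_ (tileCorners (suc m))) ≡ newVertices m
    newCorners = trans (cong (removeAll _≟ₚ_ rawVertices ∘ deduplicate _≟ₚ_) (tileCorners-suc m))
      (byParity-elim (λ corners → removeAll _≟ₚ_ rawVertices (deduplicate _≟ₚ_ corners) ≡ newVertices m) m even odd)
      where
      s₀∈ : s₀ ∈ rawVertices
      s₀∈ = ∈-deduplicate⁻ _≟ₚ_ rawVertices spine∈vertices
      s₁∈ : s₁ ∈ rawVertices
      s₁∈ = ∈-deduplicate⁻ _≟ₚ_ rawVertices spine-suc∈vertices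
      o∉ : o ∉ rawVertices
      o∉ = vertex∉ (outer-new m)
      s₂∉ : s₂ ∉ rawVertices
      s₂∉ = vertex∉ (spine-new m)

      even : removeAll _≟ₚ_ rawVertices (deduplicate _≟ₚ_ (s₀ ∷ s₁ ∷ o ∷ s₂ ∷ [])) ≡ newVertices m
      even rewrite deduplicate-unique _≟ₚ_ {s₀ ∷ s₁ ∷ o ∷ s₂ ∷ []}
                     ((s₀≢s₁ ∷ s₀≢o ∷ s₀≢s₂ ∷ []) ∷ (s₁≢o ∷ s₁≢s₂ ∷ []) ∷ (≢-sym s₂≢o ∷ []) ∷ [] ∷ [])
                 | removeAll-∈ _≟ₚ_ rawVertices (s₁ ∷ o ∷ s₂ ∷ []) s₀∈
                 | removeAll-∈ _≟ₚ_ rawVertices (o ∷ s₂ ∷ []) s₁∈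
                 | removeAll-∉ _≟ₚ_ rawVertices (s₂ ∷ []) o∉ | removeAll-∉ _≟ₚ_ rawVertices [] s₂∉
                 | removeAll-[] _≟ₚ_ rawVertices = refl

      odd : removeAll _≟ₚ_ rawVertices (deduplicate _≟ₚ_ (s₀ ∷ o ∷ s₁ ∷ s₂ ∷ [])) ≡ newVertices m
      odd rewrite deduplicate-unique _≟ₚ_ {s₀ ∷ o ∷ s₁ ∷ s₂ ∷ []}
                    ((s₀≢o ∷ s₀≢s₁ ∷ s₀≢s₂ ∷ []) ∷ (≢-sym s₁≢o ∷ ≢-sym s₂≢o ∷ []) ∷ (s₁≢s₂ ∷ []) ∷ [] ∷ [])
                | removeAll-∈ _≟ₚ_ rawVertices (o ∷ s₁ ∷ s₂ ∷ []) s₀∈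
                | removeAll-∉ _≟ₚ_ rawVertices (s₁ ∷ s₂ ∷ []) o∉
                | removeAll-∈ _≟ₚ_ rawVertices (s₂ ∷ []) s₁∈ | removeAll-∉ _≟ₚ_ rawVertices [] s₂∉
                | removeAll-[] _≟ₚ_ rawVertices = refl

  edges-suc : edges (suc (suc m)) ≡ edges (suc m) ++ newEdges m
  edges-suc = trans (deduplicate-concatMap-upTo-suc _≟ₛ_ tileSides (suc m)) (cong (edges (suc m) ++_) newSides)

  vertices-suc : vertices (suc (suc m)) ≡ vertices (suc m) ++ newVertices m
  vertices-suc = trans (deduplicate-concatMap-upTo-suc _≟ₚ_ tileCorners (suc m)) (cong (vertices (suc m) ++_) newCorners)

  shape-suc : SnakeShape (suc m)
  shape-suc = record
    { vertices-old       = subst (All (Old (suc m))) (sym vertices-suc)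
                             (++⁺ (All.map Old-suc vertices-old) (o-old ∷ s₂-old ∷ []))
    ; edges-old          = subst (All (OldSide (suc m))) (sym edges-suc)
                             (++⁺ (All.map (λ { {_ , _} (p , q) → Old-suc p , Old-suc q }) edges-old)
                                  (byParity-elim (All (OldSide (suc m))) m
                                    ((o-old , s₂-old) ∷ (s₀-old , o-old) ∷ (s₁-old , s₂-old) ∷ [])
                                    ((s₀-old , o-old) ∷ (s₁-old , s₂-old) ∷ (o-old , s₂-old) ∷ [])))
    ; spine∈vertices     = subst (s₁ ∈_) (sym vertices-suc) (∈-++⁺ˡ spine-suc∈vertices)
    ; spine-suc∈vertices = subst (s₂ ∈_) (sym vertices-suc) (∈-++⁺ʳ (vertices (suc m)) (there (here refl)))
    ; spineSide∈edges    = subst (c ∈_) (sym edges-suc) (∈-++⁺ʳ (edges (suc m))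
                             (byParity-elim (c ∈_) m (there (there (here refl))) (there (here refl))))
    }
    where
    s₀-old : Old (suc m) s₀
    s₀-old = Old-suc (inj₂ (inj₁ refl))
    s₁-old : Old (suc m) s₁
    s₁-old = inj₂ (inj₁ refl)
    s₂-old : Old (suc m) s₂
    s₂-old = inj₂ (inj₂ refl)
    o-old : Old (suc m) o
    o-old = inj₁ (suc m , ≤-refl , inj₂ refl)

snakeShape : ∀ m → SnakeShape m
snakeShape zero    = record
  { vertices-old       = P₀ (inj₁ refl) ∷ P₀ (inj₂ refl) ∷ inj₂ (inj₁ refl) ∷ inj₂ (inj₂ refl) ∷ []
  ; edges-old          = (P₀ (inj₁ refl) , P₀ (inj₂ refl)) ∷ (inj₂ (inj₁ refl) , inj₂ (inj₂ refl))
                       ∷ (P₀ (inj₁ refl) , inj₂ (inj₁ refl)) ∷ (P₀ (inj₂ refl) , inj₂ (inj₂ refl)) ∷ []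
  ; spine∈vertices     = there (there (here refl))
  ; spine-suc∈vertices = there (there (there (here refl)))
  ; spineSide∈edges    = there (here refl)
  }
  where
  P₀ : ∀ {v} → v ∈ₛ pair 0 → Old 0 v
  P₀ v∈ = inj₁ (0 , z≤n , v∈)
snakeShape (suc m) = Growth.shape-suc m (snakeShape m)

module Extension (m y : ℕ) where

  open SnakeShape (snakeShape m)
  open Growth m (snakeShape m) using (edges-suc; vertices-suc)
  open Tile m

  private
    E Eₙ : List Seg
    E  = edges (suc m)
    Eₙ = newEdges m

  α β γ : Vec ℕ (length Eₙ) → ℕ
  α = weightA {a} {b} {c} m
  β = weightB {a} {b} {c} m
  γ = weightC {a} {b} {c} m

  newSum : Vec ℕ (length Eₙ) → Pt → ℕ
  newSum ν v = weightAt v a (α ν) + weightAt v b (β ν) + weightAt v c (γ ν)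

  bigLabel : Pt → ℕ
  bigLabel = label (suc (suc m)) (lastLabel (suc (suc m)) y)

  smallLabel : ℕ → Pt → ℕ
  smallLabel x = label (suc m) (lastLabel (suc m) x)

  incSum-extend : ∀ v ω ν → incSum v (E ++ Eₙ) (glue E Eₙ ω ν) ≡ incSum v E ω + newSum ν v
  incSum-extend v ω ν = trans (incSum-glue v E Eₙ ω ν) (cong (incSum v E ω +_) (incSum-byParity₃ m v ν))

  incSum-new : ∀ {v} ω → ¬ Old m v → incSum v E ω ≡ 0
  incSum-new {v} ω ¬old = incSum-away v E ω
    (All.map (λ { {_ , _} (p-old , q-old) → ∉-ends (λ { refl → ¬old p-old }) (λ { refl → ¬old q-old }) }) edges-old)

  mult-extend : ∀ ω ν → mult b (E ++ Eₙ) (glue E Eₙ ω ν) ≡ β ν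
  mult-extend ω ν = begin
    mult b (E ++ Eₙ) (glue E Eₙ ω ν) ≡⟨ mult-glue b E Eₙ ω ν ⟩
    mult b E ω + mult b Eₙ ν         ≡⟨ cong₂ _+_ (mult-away b E ω b∉E) (mult-byParity₃-b m ν b≢a b≢c) ⟩
    0 + β ν                          ∎
    where
    open ≡-Reasoning
    b∉E : All (b ≢_) E
    b∉E = All.map (λ { {_ , _} (o-old , _) refl → outer-new m o-old }) edges-old
    b≢a : b ≢ a
    b≢a = ≢-fst (≢-sym s₀≢o)
    b≢c : b ≢ c
    b≢c = ≢-fst (≢-sym s₁≢o)

  newSum-spine₀ : ∀ ν → newSum ν s₀ ≡ α ν
  newSum-spine₀ ν
    rewrite weightAt-∈ₛ {s₀} {a} (α ν) (inj₁ refl)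
          | weightAt-∉ₛ {s₀} {b} (β ν) (∉-ends s₀≢o s₀≢s₂)
          | weightAt-∉ₛ {s₀} {c} (γ ν) (∉-ends s₀≢s₁ s₀≢s₂) = trans (+-identityʳ _) (+-identityʳ _)

  newSum-spine₁ : ∀ ν → newSum ν s₁ ≡ γ ν
  newSum-spine₁ ν
    rewrite weightAt-∉ₛ {s₁} {a} (α ν) (∉-ends (≢-sym s₀≢s₁) s₁≢o)
          | weightAt-∉ₛ {s₁} {b} (β ν) (∉-ends s₁≢o s₁≢s₂)
          | weightAt-∈ₛ {s₁} {c} (γ ν) (inj₁ refl) = refl

  newSum-outer : ∀ ν → newSum ν o ≡ α ν + β ν
  newSum-outer ν
    rewrite weightAt-∈ₛ {o} {a} (α ν) (inj₂ refl)
          | weightAt-∈ₛ {o} {b} (β ν) (inj₁ refl)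
          | weightAt-∉ₛ {o} {c} (γ ν) (∉-ends (≢-sym s₁≢o) (≢-sym s₂≢o)) = +-identityʳ _

  newSum-spine₂ : ∀ ν → newSum ν s₂ ≡ β ν + γ ν
  newSum-spine₂ ν
    rewrite weightAt-∉ₛ {s₂} {a} (α ν) (∉-ends (≢-sym s₀≢s₂) s₂≢o)
          | weightAt-∈ₛ {s₂} {b} (β ν) (inj₂ refl)
          | weightAt-∈ₛ {s₂} {c} (γ ν) (inj₂ refl) = refl

  newSum-interior : ∀ ν {v p} → p ≤ m → v ∈ₛ pair p → newSum ν v ≡ 0
  newSum-interior ν {v} {p} p≤m v∈
    rewrite weightAt-∉ₛ {v} {a} (α ν) (∉-ends (pairs-apart v∈ (spine∈ₛ m) (s≤s p≤m))
                                               (pairs-apart v∈ (outer∈ₛ m) (s≤s p≤m)))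
          | weightAt-∉ₛ {v} {b} (β ν) (∉-ends (pairs-apart v∈ (outer∈ₛ m) (s≤s p≤m))
                                               (pairs-apart v∈ (spine∈ₛ (suc (suc m))) (s≤s (≤-trans p≤m (m≤n+m m 2)))))
          | weightAt-∉ₛ {v} {c} (γ ν) (∉-ends (pairs-apart v∈ (spine∈ₛ (suc m)) (s≤s (≤-trans p≤m (n≤1+n m))))
                                               (pairs-apart v∈ (spine∈ₛ (suc (suc m))) (s≤s (≤-trans p≤m (m≤n+m m 2)))))
          = refl

  balance : ∀ ν x → α ν + x ≡ suc (suc m) → x + γ ν ≡ y →
            ∀ {v} → Old m v → smallLabel x v + newSum ν v ≡ bigLabel v
  balance ν x αx≡ xγ≡ {v} (inj₁ (p , p≤m , v∈)) = begin
    smallLabel x v + newSum ν v ≡⟨ cong₂ _+_ (label-< v∈ (suc m) x (s≤s p≤m)) (newSum-interior ν p≤m v∈) ⟩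
    suc p + 0                   ≡⟨ +-identityʳ (suc p) ⟩
    suc p                       ≡⟨ label-< v∈ (suc (suc m)) y (s≤s (≤-trans p≤m (n≤1+n m))) ⟨
    bigLabel v                  ∎
    where open ≡-Reasoning
  balance ν x αx≡ xγ≡ (inj₂ (inj₁ refl)) = begin
    smallLabel x s₀ + newSum ν s₀ ≡⟨ cong₂ _+_ (label-≥ (spine∈ₛ m) (suc m) x ≤-refl) (newSum-spine₀ ν) ⟩
    x + α ν                       ≡⟨ +-comm x (α ν) ⟩
    α ν + x                       ≡⟨ αx≡ ⟩
    suc (suc m)                   ≡⟨ label-< (spine∈ₛ m) (suc (suc m)) y ≤-refl ⟨
    bigLabel s₀                   ∎
    where open ≡-Reasoning
  balance ν x αx≡ xγ≡ (inj₂ (inj₂ refl)) = begin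
    smallLabel x s₁ + newSum ν s₁ ≡⟨ cong₂ _+_ (label-≥ (spine∈ₛ (suc m)) (suc m) x (n≤1+n (suc m))) (newSum-spine₁ ν) ⟩
    x + γ ν                       ≡⟨ xγ≡ ⟩
    y                             ≡⟨ label-≥ (spine∈ₛ (suc m)) (suc (suc m)) y ≤-refl ⟨
    bigLabel s₁                   ∎
    where open ≡-Reasoning

  incSum-outer : ∀ ω ν → incSum o (E ++ Eₙ) (glue E Eₙ ω ν) ≡ α ν + β ν
  incSum-outer ω ν = trans (incSum-extend o ω ν) (cong₂ _+_ (incSum-new ω (outer-new m)) (newSum-outer ν))

  incSum-spine₂ : ∀ ω ν → incSum s₂ (E ++ Eₙ) (glue E Eₙ ω ν) ≡ β ν + γ ν
  incSum-spine₂ ω ν = trans (incSum-extend s₂ ω ν) (cong₂ _+_ (incSum-new ω (spine-new m)) (newSum-spine₂ ν))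

  bigLabel-outer : bigLabel o ≡ suc (suc m)
  bigLabel-outer = label-< (outer∈ₛ m) (suc (suc m)) y ≤-refl

  bigLabel-spine₂ : bigLabel s₂ ≡ y
  bigLabel-spine₂ = label-≥ (spine∈ₛ (suc (suc m))) (suc (suc m)) y (n≤1+n _)

  -- weight vectors of G_{m+2} are indexed by edges (m+2), which is E ++ Eₙ only propositionally
  CoverOn : (es : List Seg) → Vec ℕ (length es) → Set
  CoverOn es ω = All (λ v → incSum v es ω ≡ bigLabel v) (vertices (suc (suc m)))

  module _ (ω : Vec ℕ (length (E ++ Eₙ))) where

    private
      AtVertex : Pt → Set
      AtVertex v = incSum v (E ++ Eₙ) ω ≡ bigLabel v

    split-cover : CoverOn (E ++ Eₙ) ω → All AtVertex (vertices (suc m)) × All AtVertex (newVertices m)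
    split-cover = ++⁻ (vertices (suc m)) ∘ subst (All AtVertex) vertices-suc

    join-cover : All AtVertex (vertices (suc m)) → All AtVertex (newVertices m) → CoverOn (E ++ Eₙ) ω
    join-cover old new = subst (All AtVertex) (sym vertices-suc) (++⁺ old new)

  newVertex-conditions : ∀ ω ν → CoverOn (E ++ Eₙ) (glue E Eₙ ω ν) → α ν + β ν ≡ suc (suc m) × β ν + γ ν ≡ y
  newVertex-conditions ω ν cover with proj₂ (split-cover (glue E Eₙ ω ν) cover)
  ... | at-outer ∷ at-spine₂ ∷ [] = trans (sym (incSum-outer ω ν)) (trans at-outer bigLabel-outer)
                                  , trans (sym (incSum-spine₂ ω ν)) (trans at-spine₂ bigLabel-spine₂)

  module Fibre (x : ℕ) (x≤ : x ≤ suc (suc m)) (x≤y : x ≤ y) where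

    SmallCover : Vec ℕ (length E) → Set
    SmallCover = IsMixedDimerCover (suc m) (lastLabel (suc m) x)

    InFibre : Vec ℕ (length (E ++ Eₙ)) → Set
    InFibre ω = CoverOn (E ++ Eₙ) ω × mult b (E ++ Eₙ) ω ≡ x

    ν₀ : Vec ℕ (length Eₙ)
    ν₀ = fromWeights m (suc (suc m) ∸ x) x (y ∸ x)

    extend : Vec ℕ (length E) → Vec ℕ (length (E ++ Eₙ))
    extend ω = glue E Eₙ ω ν₀

    extend-fibre : ∀ ω → SmallCover ω → InFibre (extend ω)
    extend-fibre ω small = join-cover (extend ω) (All.zipWith old (vertices-old , small)) (at-outer ∷ at-spine₂ ∷ [])
                         , trans (mult-extend ω ν₀) β₀
      where
      α₀ : α ν₀ ≡ suc (suc m) ∸ x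
      α₀ = weightA-fromWeights m _ _ _
      β₀ : β ν₀ ≡ x
      β₀ = weightB-fromWeights m _ _ _
      γ₀ : γ ν₀ ≡ y ∸ x
      γ₀ = weightC-fromWeights m _ _ _

      old : ∀ {v} → Old m v × incSum v E ω ≡ smallLabel x v → incSum v (E ++ Eₙ) (extend ω) ≡ bigLabel v
      old {v} (v-old , at-v) = trans (incSum-extend v ω ν₀) (trans (cong (_+ newSum ν₀ v) at-v)
        (balance ν₀ x (trans (cong (_+ x) α₀) (m∸n+n≡m x≤)) (trans (cong (x +_) γ₀) (m+[n∸m]≡n x≤y)) v-old))

      at-outer : incSum o (E ++ Eₙ) (extend ω) ≡ bigLabel o
      at-outer = trans (incSum-outer ω ν₀)
                       (trans (cong₂ _+_ α₀ β₀) (trans (m∸n+n≡m x≤) (sym bigLabel-outer)))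

      at-spine₂ : incSum s₂ (E ++ Eₙ) (extend ω) ≡ bigLabel s₂
      at-spine₂ = trans (incSum-spine₂ ω ν₀)
                        (trans (cong₂ _+_ β₀ γ₀) (trans (m+[n∸m]≡n x≤y) (sym bigLabel-spine₂)))

    restrict-glue : ∀ ω ν → InFibre (glue E Eₙ ω ν) → SmallCover ω × ν ≡ ν₀
    restrict-glue ω ν (cover , mult≡x) = All.zipWith old (vertices-old , proj₁ (split-cover (glue E Eₙ ω ν) cover)) , ν≡ν₀
      where
      β≡ : β ν ≡ x
      β≡ = trans (sym (mult-extend ω ν)) mult≡x
      αx≡ : α ν + x ≡ suc (suc m)
      αx≡ = subst (λ t → α ν + t ≡ suc (suc m)) β≡ (proj₁ (newVertex-conditions ω ν cover))
      xγ≡ : x + γ ν ≡ y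
      xγ≡ = subst (λ t → t + γ ν ≡ y) β≡ (proj₂ (newVertex-conditions ω ν cover))

      old : ∀ {v} → Old m v × incSum v (E ++ Eₙ) (glue E Eₙ ω ν) ≡ bigLabel v → incSum v E ω ≡ smallLabel x v
      old {v} (v-old , at-v) = +-cancelʳ-≡ (newSum ν v) _ _
        (trans (sym (incSum-extend v ω ν)) (trans at-v (sym (balance ν x αx≡ xγ≡ v-old))))

      ν≡ν₀ : ν ≡ ν₀
      ν≡ν₀ = begin
        ν                                             ≡⟨ fromWeights-weights m ν ⟨
        fromWeights m (α ν) (β ν) (γ ν)               ≡⟨ cong₂ (λ α′ γ′ → fromWeights m α′ (β ν) γ′)
                                                           (trans (sym (m+n∸n≡m (α ν) x)) (cong (_∸ x) αx≡))
                                                           (trans (sym (m+n∸m≡n x (γ ν))) (cong (_∸ x) xγ≡)) ⟩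
        fromWeights m (suc (suc m) ∸ x) (β ν) (y ∸ x) ≡⟨ cong (λ β′ → fromWeights m _ β′ _) β≡ ⟩
        ν₀                                            ∎
        where open ≡-Reasoning

    restrict : ∀ ω → InFibre ω → SmallCover (leftPart E Eₙ ω) × extend (leftPart E Eₙ ω) ≡ ω
    restrict = glue-elim E Eₙ (λ ω → InFibre ω → SmallCover (leftPart E Eₙ ω) × extend (leftPart E Eₙ ω) ≡ ω)
      λ ω ν fib → let (small , ν≡ν₀) = restrict-glue ω ν fib in
        subst SmallCover (sym (leftPart-glue E Eₙ ω ν)) small ,
        trans (cong extend (leftPart-glue E Eₙ ω ν)) (cong (glue E Eₙ ω) (sym ν≡ν₀))

    Card-InFibre : ∀ {k} → Card SmallCover k → Card InFibre k
    Card-InFibre = Card-bijection extend (leftPart E Eₙ) extend-fibre (λ ω → proj₁ ∘ restrict ω)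
                                  (λ ω _ → leftPart-glue E Eₙ ω ν₀) (λ ω → proj₂ ∘ restrict ω)

  finalEdge-bound : ∀ ω → IsMixedDimerCover (suc (suc m)) (lastLabel (suc (suc m)) y) ω →
                    mult (finalEdge (suc (suc m))) (edges (suc (suc m))) ω ≤ suc (suc m)
                  × mult (finalEdge (suc (suc m))) (edges (suc (suc m))) ω ≤ y
  finalEdge-bound rewrite finalEdge-suc m = subst Bounded (sym edges-suc)
    (glue-elim E Eₙ (λ ω → CoverOn (E ++ Eₙ) ω → Bound (E ++ Eₙ) ω)
      λ ω ν cover → bound ω ν (newVertex-conditions ω ν cover))
    where
    Bound : (es : List Seg) → Vec ℕ (length es) → Set
    Bound es ω = mult b es ω ≤ suc (suc m) × mult b es ω ≤ y

    Bounded : List Seg → Set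
    Bounded es = ∀ ω → CoverOn es ω → Bound es ω

    bound : ∀ ω ν → α ν + β ν ≡ suc (suc m) × β ν + γ ν ≡ y → Bound (E ++ Eₙ) (glue E Eₙ ω ν)
    bound ω ν (αβ≡ , βγ≡) rewrite mult-extend ω ν =
      subst (β ν ≤_) αβ≡ (m≤n+m (β ν) (α ν)) , subst (β ν ≤_) βγ≡ (m≤m+n (β ν) (γ ν))

  Card-finalEdge-fibre : ∀ x → x ≤ suc (suc m) → x ≤ y → ∀ {k} →
    Card (IsMixedDimerCover (suc m) (lastLabel (suc m) x)) k →
    Card (λ ω → IsMixedDimerCover (suc (suc m)) (lastLabel (suc (suc m)) y) ω
              × mult (finalEdge (suc (suc m))) (edges (suc (suc m))) ω ≡ x) k
  Card-finalEdge-fibre x x≤ x≤y {k} rewrite finalEdge-suc m =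
    subst (λ es → Card (λ ω → CoverOn es ω × mult b es ω ≡ x) k) (sym edges-suc) ∘ Fibre.Card-InFibre x x≤ x≤y

-- Counting mixed dimer covers

finalMult : ∀ N → EdgeWeights N → ℕ
finalMult N = mult (finalEdge N) (edges N)

Card-byFinalEdge : ∀ M y →
  (∀ ω → IsMixedDimerCover (suc M) (lastLabel (suc M) y) ω → finalMult (suc M) ω ≤ suc M × finalMult (suc M) ω ≤ y) →
  (∀ x → x ≤ suc M → x ≤ y →
     Card (λ ω → IsMixedDimerCover (suc M) (lastLabel (suc M) y) ω × finalMult (suc M) ω ≡ x) (ballot (suc M) x)) →
  Card (IsMixedDimerCover (suc M) (lastLabel (suc M) y)) (ballot (suc (suc M)) y)
Card-byFinalEdge M y bound fibre =
  Card-fibres (finalMult (suc M)) (suc (suc M ⊓ y)) (ballot (suc M))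
    (λ ω cover → let (≤M , ≤y) = bound ω cover in s≤s (⊓-glb ≤M ≤y))
    λ { x (s≤s x≤) → fibre x (≤-trans x≤ (m⊓n≤m (suc M) y)) (≤-trans x≤ (m⊓n≤n (suc M) y)) }

-- G_1 is a single square with weights (bottom , top , left , right); the final edge is its right side
single-tile-bound : ∀ y ω → IsMixedDimerCover 1 (lastLabel 1 y) ω → finalMult 1 ω ≤ 1 × finalMult 1 ω ≤ y
single-tile-bound y (e ∷ c ∷ f ∷ g ∷ []) (_ ∷ eg≡1 ∷ _ ∷ cg≡y ∷ []) rewrite +-identityʳ g =
  subst (g ≤_) eg≡1 (m≤n+m g e) , subst (g ≤_) cg≡y (m≤n+m g c)

Card-single-tile-fibre : ∀ y x → x ≤ 1 → x ≤ y →
  Card (λ ω → IsMixedDimerCover 1 (lastLabel 1 y) ω × finalMult 1 ω ≡ x) 1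
Card-single-tile-fibre y x x≤1 x≤y = Card-singleton ω₀ (cover , +-identityʳ x) unique
  where
  ω₀ : EdgeWeights 1
  ω₀ = (1 ∸ x) ∷ (y ∸ x) ∷ x ∷ x ∷ []

  cover : IsMixedDimerCover 1 (lastLabel 1 y) ω₀
  cover = bottom ∷ bottom ∷ top ∷ top ∷ []
    where
    bottom : (1 ∸ x) + (x + 0) ≡ 1
    bottom = trans (cong ((1 ∸ x) +_) (+-identityʳ x)) (m∸n+n≡m x≤1)
    top : (y ∸ x) + (x + 0) ≡ y
    top = trans (cong ((y ∸ x) +_) (+-identityʳ x)) (m∸n+n≡m x≤y)

  unique : ∀ ω → IsMixedDimerCover 1 (lastLabel 1 y) ω × finalMult 1 ω ≡ x → ω ≡ ω₀
  unique (e ∷ c ∷ f ∷ g ∷ []) ((ef≡1 ∷ eg≡1 ∷ cf≡y ∷ _ ∷ []) , g≡x)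
    rewrite +-identityʳ f | +-identityʳ g = determined e c f g ef≡1 eg≡1 cf≡y g≡x
    where
    ≡∸ : ∀ {a b n} → a + b ≡ n → a ≡ n ∸ b
    ≡∸ {a} {b} refl = sym (m+n∸n≡m a b)

    determined : ∀ e c f g → e + f ≡ 1 → e + g ≡ 1 → c + f ≡ y → g ≡ x → e ∷ c ∷ f ∷ g ∷ [] ≡ ω₀
    determined e c f g ef≡1 eg≡1 cf≡y refl with refl ← +-cancelˡ-≡ e f g (trans ef≡1 (sym eg≡1)) =
      cong₂ _∷_ (≡∸ eg≡1) (cong₂ _∷_ (≡∸ cf≡y) refl)

Card-covers : ∀ M y → Card (IsMixedDimerCover M (lastLabel M y)) (ballot (suc M) y)
Card-covers zero          y = Card-singleton [] [] λ { [] _ → refl }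
Card-covers (suc zero)    y = Card-byFinalEdge 0 y (single-tile-bound y) (Card-single-tile-fibre y)
Card-covers (suc (suc m)) y = Card-byFinalEdge (suc m) y (Extension.finalEdge-bound m y)
  λ x x≤ x≤y → Extension.Card-finalEdge-fibre m y x x≤ x≤y (Card-covers (suc m) x)

module _ {M : ℕ} (ω : EdgeWeights M) where

  lastLabel⇒standard : IsMixedDimerCover M (lastLabel M (suc M)) ω → IsMixedDimerCover M standard ω
  lastLabel⇒standard = All.map λ {v} at-v → trans at-v (label-standard M v)

  standard⇒lastLabel : IsMixedDimerCover M standard ω → IsMixedDimerCover M (lastLabel M (suc M)) ω
  standard⇒lastLabel = All.map λ {v} at-v → trans at-v (sym (label-standard M v))

covers-catalan : ∀ N → ∃ λ c →
    Card (IsMixedDimerCover (suc N) standard) c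
  × Card (λ (τ : Vec (Fin (suc (suc N))) (suc (suc N))) → IsPerm τ × Avoids132 τ) c
covers-catalan N = sumBelow (suc (suc N)) (ballot (suc N)) ,
  subst (Card _) (ballot-saturated (suc N) (suc (suc N)) (n≤1+n _))
    (Card-resp lastLabel⇒standard standard⇒lastLabel (Card-covers (suc N) (suc (suc N)))) ,
  Card-avoiding (suc N)

covers-ballot : ∀ N y → y ≤ suc (suc N) → ∀ {w} → w ≡ suc y → ∃ λ c →
    Card (λ ω → IsMixedDimerCover (suc (suc N)) standard ω × finalMult (suc (suc N)) ω ≡ y) c
  × Card (IsMixedDimerCover (suc N) (lastLabel (suc N) y)) c
  × Card (λ (τ : Vec (Fin (suc (suc (suc N)))) (suc (suc (suc N)))) → IsPerm τ × Avoids132 τ × firstValue τ ≡ w) c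
covers-ballot N y y≤ refl = ballot (suc (suc N)) y ,
  Card-resp (λ ω (cover , final) → lastLabel⇒standard ω cover , final)
            (λ ω (cover , final) → standard⇒lastLabel ω cover , final)
    (Extension.Card-finalEdge-fibre N (suc (suc (suc N))) y y≤ (≤-trans y≤ (n≤1+n _)) (Card-covers (suc N) y)) ,
  Card-covers (suc N) y ,
  Card-resp (λ { (_ ∷ _) (perm , avoids , head≡y) → perm , avoids , cong suc head≡y })
            (λ { (_ ∷ _) (perm , avoids , first≡) → perm , avoids , cong pred first≡ })
            (Card-avoiding-head (suc (suc N)) y y≤)

theorem5 :
    ((n : ℕ) → 2 ≤ n →
      ∃ λ c →
          Card (IsMixedDimerCover (n ∸ 1) standard) c
        × Card (λ (τ : Vec (Fin n) n) → IsPerm τ × Avoids132 τ) c)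
    ×
    ((n k : ℕ) → 3 ≤ n → 2 ≤ k → k ≤ suc n →
      ∃ λ c →
          Card (λ ω → IsMixedDimerCover (n ∸ 1) standard ω
                    × mult (finalEdge (n ∸ 1)) (edges (n ∸ 1)) ω ≡ suc n ∸ k) c
        × Card (IsMixedDimerCover (n ∸ 2) (lastLabel (n ∸ 2) (suc n ∸ k))) c
        × Card (λ (τ : Vec (Fin n) n) →
                  IsPerm τ × Avoids132 τ × firstValue τ ≡ (n + 2) ∸ k) c)
theorem5 =
    (λ { (suc zero) (s≤s ())
       ; (suc (suc N)) _ → covers-catalan N })
  , λ { (suc zero)          _              (s≤s ())       _        _
      ; (suc (suc zero))    _              (s≤s (s≤s ())) _        _
      ; (suc (suc (suc N))) (suc zero)     _              (s≤s ()) _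
      ; (suc (suc (suc N))) (suc (suc k)) _             _        (s≤s (s≤s k≤)) →
          covers-ballot N (suc (suc N) ∸ k) (m∸n≤m _ k)
            (trans (cong (λ t → suc t ∸ k) (+-comm N 2)) (+-∸-assoc 1 k≤)) }
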